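{- Let $0\le k_1\le k_2\le\cdots\le k_s\le N$ be fixed integers, let $1\le r\le s$ and $m\ge k_r$. Then $$T_{r-1}(m,k_1,\ldots,k_r)=k_r\cdot(m-1)!+(m-1)!\cdot\sum_{i=k_r+1}^{m}\frac{T_{r-2}(i-1,k_1,\ldots,k_{r-1})}{(i-1)!},$$ with the convention $T_{ -1}\equiv 0$.
   Context: For integers $0\le k_1\le\cdots\le k_r$, the $(k_1,\ldots,k_r)$-strategy applied to a permutation $\pi$ of length $m$ (entries revealed from the left, only relative order observed) proceeds as follows: for the $i$-th selection ($1\le i\le r$) it waits until the $(i-1)$-th selection has been made (if $i\ge 2$), rejects the first $k_i$ positions, and selects the next position that is a left-to-right maximum of $\pi$ (a position whose value exceeds all values to its left); at most $r$ selections are made. For $q\ge 0$, $T_q(m,k_1,\ldots,k_r)$ denotes the number of permutations $\pi\in S_m$ on which the $(k_1,\ldots,k_r)$-strategy makes at most $q$ selections. -}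

module Defs where

open import Data.Nat using (ℕ; zero; suc; _+_; _∸_; _<ᵇ_; _≤?_)
open import Data.Bool using (Bool; true; false; _∧_; if_then_else_)
open import Data.List using (List; []; _∷_; length; map; concatMap; filter; applyUpTo; foldr)
open import Data.Rational using (ℚ; 0ℚ) renaming (_+_ to _+ℚ_)

insertions : ℕ → List ℕ → List (List ℕ)
insertions x [] = (x ∷ []) ∷ []
insertions x (y ∷ ys) = (x ∷ y ∷ ys) ∷ map (y ∷_) (insertions x ys)

-- The symmetric group S_m, as the list of all m! arrangements of the
-- values 0,1,...,m-1 (a permutation π is the word π(1)π(2)...π(m)).
perms : ℕ → List (List ℕ)
perms zero = [] ∷ []
perms (suc n) = concatMap (insertions n) (perms n)

allᵇ : (ℕ → Bool) → List ℕ → Bool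
allᵇ p [] = true
allᵇ p (y ∷ ys) = p y ∧ allᵇ p ys

-- Arguments: the already-revealed prefix (in reverse order), the list of
-- thresholds of the selections still to be made, and the unrevealed part.
-- The element x being revealed is at position (length prefix + 1); it is a
-- left-to-right maximum iff it exceeds every earlier value.  The next
-- selection (threshold k) is made at x iff its position exceeds k and x is a
-- left-to-right maximum; positions up to (and including) the previous
-- selection are already consumed, so the waiting condition is automatic.
selectionsFrom : List ℕ → List ℕ → List ℕ → ℕ
selectionsFrom prefix ks [] = 0
selectionsFrom prefix [] (x ∷ xs) = 0
selectionsFrom prefix (k ∷ ks) (x ∷ xs) =
  if (k <ᵇ suc (length prefix)) ∧ allᵇ (λ y → y <ᵇ x) prefix
  then suc (selectionsFrom (x ∷ prefix) ks xs)
  else selectionsFrom (x ∷ prefix) (k ∷ ks) xs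

selections : List ℕ → List ℕ → ℕ
selections ks π = selectionsFrom [] ks π

Tcount : ℕ → ℕ → List ℕ → ℕ
Tcount q m ks = length (filter (λ π → selections ks π ≤? q) (perms m))

-- Shifted version with the convention T_{-1} ≡ 0:
-- Tshift j m ks = T_{j-1}(m, ks).
Tshift : ℕ → ℕ → List ℕ → ℕ
Tshift zero m ks = 0
Tshift (suc q) m ks = Tcount q m ks

firstK : (ℕ → ℕ) → ℕ → List ℕ
firstK k r = applyUpTo (λ j → k (suc j)) r

-- Σ_{i=a}^{b} f i over the rationals (empty sum = 0 when b < a).
sumFromTo : ℕ → ℕ → (ℕ → ℚ) → ℚ
sumFromTo a b f = foldr _+ℚ_ 0ℚ (map f (applyUpTo (λ j → a + j) (suc b ∸ a)))

-- Only the pattern of left-to-right maxima ("records") of π matters to the strategy, and this pattern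
-- is built up by independent choices: of the m ways to extend a permutation of length m − 1 by a last
-- entry, exactly one makes position m a record.  If position m is not a record, the strategy behaves as
-- on the first m − 1 positions; if it is a record and m > k_r, it is selected on top of what the
-- (k_1,…,k_{r−1})-strategy selects among the first m − 1 positions.  Hence, for m > k_r,
--   T_{r−1}(m; k_1,…,k_r) = (m − 1)·T_{r−1}(m − 1; k_1,…,k_r) + T_{r−2}(m − 1; k_1,…,k_{r−1}),
-- while T_{r−1}(k_r; k_1,…,k_r) = k_r! since the r-th selection needs a position beyond k_r.
-- Divided by (m − 1)!, the recurrence telescopes to the stated formula.

module Submission where

open import Defs
open import Data.Bool using (Bool; true; false; _∧_; if_then_else_; T)
open import Data.Bool.Properties using (∧-zeroʳ; T-≡)
open import Data.Empty using (⊥-elim)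
open import Data.List using (List; []; _∷_; length; map; concatMap; filter; foldr; applyUpTo; _++_; _∷ʳ_)
open import Data.List.Properties using (map-++; map-∘; length-map; length-++; foldr-++; applyUpTo-∷ʳ; length-applyUpTo)
open import Data.List.Membership.Propositional using (_∈_)
open import Data.List.Relation.Unary.All as All using (All; []; _∷_)
open import Data.List.Relation.Unary.All.Properties using (++⁺; map⁺; applyUpTo⁺₁)
open import Data.List.Relation.Unary.Any using (here; there)
open import Data.Nat as ℕ using (ℕ; zero; suc; _∸_; _≤_; _<_; _≤′_; ≤′-refl; ≤′-step; _≤ᵇ_; _<ᵇ_; _≤?_; _⊓_; _!; s≤s; z≤n; NonZero)
open import Data.Nat.Properties
  using ( m≤m+n; ≤-refl; ≤-trans; ≤-reflexive; <⇒≤; <⇒≱; m≤n⇒m≤1+n; m≤n⇒m<n∨m≡n; ≤′⇒≤; ≤⇒≤′; <ᵇ⇒<; <⇒<ᵇ; ≤⇒≤ᵇ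
        ; +-suc; +-comm; +-assoc; +-identityʳ; ⊓-zeroʳ; _!≢0; n∸n≡0; +-∸-assoc; m+[n∸m]≡n)
open import Data.Nat.Solver as ℕ-Solver using ()
open import Data.Sum using (inj₁; inj₂)
open import Data.Unit using (tt)
open import Function using (_∘_; const)
open import Function.Bundles using (Equivalence)
open import Relation.Nullary using (does)
open import Relation.Unary using (Decidable)
open import Relation.Binary.PropositionalEquality

module RecordCounting where
  open import Data.Nat using (_+_; _*_)
  open ℕ-Solver.+-*-Solver using (solve; _:+_; _:*_; _:=_)

  private
    variable
      A B : Set

  ≥⇒<ᵇ≡false : ∀ {m n} → n ≤ m → (m <ᵇ n) ≡ false
  ≥⇒<ᵇ≡false {m} {n} n≤m with m <ᵇ n in eq
  ... | false = refl
  ... | true  = ⊥-elim (<⇒≱ (<ᵇ⇒< m n (subst T (sym eq) tt)) n≤m)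

  ≤ᵇ-suc : ∀ m n → (suc m ≤ᵇ suc n) ≡ (m ≤ᵇ n)
  ≤ᵇ-suc zero    n = refl
  ≤ᵇ-suc (suc m) n = refl

  ≤-+-suc : ∀ {k} m n → k ≤ m + suc n → k ≤ suc m + n
  ≤-+-suc m n k≤ = ≤-trans k≤ (≤-reflexive (+-suc m n))

  +-suc-≤ : ∀ {o} m n → m + suc n ≤ o → suc m + n ≤ o
  +-suc-≤ m n ≤o = ≤-trans (≤-reflexive (sym (+-suc m n))) ≤o

  length-∷ʳ : (xs : List A) (x : A) → length (xs ∷ʳ x) ≡ suc (length xs)
  length-∷ʳ xs x = trans (length-++ xs) (+-comm (length xs) 1)

  All-concatMap : {P : A → Set} {Q : B → Set} (f : A → List B) {xs : List A} →
                  (∀ {x} → P x → All Q (f x)) → All P xs → All Q (concatMap f xs)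
  All-concatMap f h []       = []
  All-concatMap f h (p ∷ ps) = ++⁺ (h p) (All-concatMap f h ps)

  sumOver : List A → (A → ℕ) → ℕ
  sumOver []       h = 0
  sumOver (x ∷ xs) h = h x + sumOver xs h

  sumOver-++ : (xs ys : List A) (h : A → ℕ) → sumOver (xs ++ ys) h ≡ sumOver xs h + sumOver ys h
  sumOver-++ []       ys h = refl
  sumOver-++ (x ∷ xs) ys h rewrite sumOver-++ xs ys h = sym (+-assoc (h x) _ _)

  sumOver-concatMap : (g : A → List B) (xs : List A) (h : B → ℕ) →
                      sumOver (concatMap g xs) h ≡ sumOver xs (λ x → sumOver (g x) h)
  sumOver-concatMap g []       h = refl
  sumOver-concatMap g (x ∷ xs) h =
    trans (sumOver-++ (g x) _ h) (cong (sumOver (g x) h +_) (sumOver-concatMap g xs h))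

  sumOver-map : (f : A → B) (xs : List A) (h : B → ℕ) → sumOver (map f xs) h ≡ sumOver xs (h ∘ f)
  sumOver-map f []       h = refl
  sumOver-map f (x ∷ xs) h = cong (h (f x) +_) (sumOver-map f xs h)

  sumOver-cong : {xs : List A} {h h′ : A → ℕ} → All (λ x → h x ≡ h′ x) xs → sumOver xs h ≡ sumOver xs h′
  sumOver-cong []       = refl
  sumOver-cong (e ∷ es) = cong₂ _+_ e (sumOver-cong es)

  sumOver-+ : (xs : List A) (g h : A → ℕ) → sumOver xs (λ x → g x + h x) ≡ sumOver xs g + sumOver xs h
  sumOver-+ []       g h = refl
  sumOver-+ (x ∷ xs) g h rewrite sumOver-+ xs g h =
    solve 4 (λ a b c d → (a :+ b) :+ (c :+ d) := (a :+ c) :+ (b :+ d)) refl (g x) (h x) (sumOver xs g) (sumOver xs h)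

  sumOver-zero : (xs : List A) → sumOver xs (const 0) ≡ 0
  sumOver-zero []       = refl
  sumOver-zero (x ∷ xs) = sumOver-zero xs

  indicator : Bool → ℕ
  indicator b = if b then 1 else 0

  indicator-≤ᵇ : ∀ {m n} → m ≤ n → indicator (m ≤ᵇ n) ≡ 1
  indicator-≤ᵇ m≤n rewrite Equivalence.to T-≡ (≤⇒≤ᵇ m≤n) = refl

  length-filter≡sumOver : {P : A → Set} (P? : Decidable P) (xs : List A) →
                          length (filter P? xs) ≡ sumOver xs (indicator ∘ does ∘ P?)
  length-filter≡sumOver P? []       = refl
  length-filter≡sumOver P? (x ∷ xs) with does (P? x)
  ... | true  = cong suc (length-filter≡sumOver P? xs)
  ... | false = length-filter≡sumOver P? xs

  recordFlags : List ℕ → List ℕ → List Bool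
  recordFlags pre []       = []
  recordFlags pre (x ∷ xs) = allᵇ (_<ᵇ x) pre ∷ recordFlags (x ∷ pre) xs

  selectionsᴿ : ℕ → List ℕ → List Bool → ℕ
  selectionsᴿ n ks       []       = 0
  selectionsᴿ n []       (b ∷ bs) = 0
  selectionsᴿ n (k ∷ ks) (b ∷ bs) =
    if (k <ᵇ suc n) ∧ b then suc (selectionsᴿ (suc n) ks bs) else selectionsᴿ (suc n) (k ∷ ks) bs

  selectionsFrom-recordFlags : ∀ pre ks xs → selectionsFrom pre ks xs ≡ selectionsᴿ (length pre) ks (recordFlags pre xs)
  selectionsFrom-recordFlags pre ks       []       = refl
  selectionsFrom-recordFlags pre []       (x ∷ xs) = refl
  selectionsFrom-recordFlags pre (k ∷ ks) (x ∷ xs) with (k <ᵇ suc (length pre)) ∧ allᵇ (_<ᵇ x) pre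
  ... | true  = cong suc (selectionsFrom-recordFlags (x ∷ pre) ks xs)
  ... | false = selectionsFrom-recordFlags (x ∷ pre) (k ∷ ks) xs

  nonRecords : List Bool → List Bool
  nonRecords = map (const false)

  insertMax : List Bool → List (List Bool)
  insertMax []       = (true ∷ []) ∷ []
  insertMax (b ∷ bs) = (true ∷ nonRecords (b ∷ bs)) ∷ map (b ∷_) (insertMax bs)

  recordWords : ℕ → List (List Bool)
  recordWords zero    = [] ∷ []
  recordWords (suc n) = concatMap insertMax (recordWords n)

  allᵇ-<ᵇ-true : ∀ {x} pre → All (_< x) pre → allᵇ (_<ᵇ x) pre ≡ true
  allᵇ-<ᵇ-true []        []       = refl
  allᵇ-<ᵇ-true (y ∷ pre) (p ∷ ps) rewrite Equivalence.to T-≡ (<⇒<ᵇ p) = allᵇ-<ᵇ-true pre ps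

  allᵇ-<ᵇ-false : ∀ {x y} pre → x ∈ pre → y < x → allᵇ (_<ᵇ y) pre ≡ false
  allᵇ-<ᵇ-false (z ∷ pre) (here refl) y<x rewrite ≥⇒<ᵇ≡false (<⇒≤ y<x) = refl
  allᵇ-<ᵇ-false {y = y} (z ∷ pre) (there x∈) y<x rewrite allᵇ-<ᵇ-false pre x∈ y<x = ∧-zeroʳ (z <ᵇ y)

  -- pre′ is arbitrary: it only fixes the length of the right-hand side.
  recordFlags-belowRevealed : ∀ {x} pre pre′ ys → x ∈ pre → All (_< x) ys →
                              recordFlags pre ys ≡ nonRecords (recordFlags pre′ ys)
  recordFlags-belowRevealed pre pre′ []       x∈ []       = refl
  recordFlags-belowRevealed pre pre′ (y ∷ ys) x∈ (p ∷ ps) =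
    cong₂ _∷_ (allᵇ-<ᵇ-false pre x∈ p) (recordFlags-belowRevealed (y ∷ pre) (y ∷ pre′) ys (there x∈) ps)

  recordFlags-insertions : ∀ x pre ys → All (_< x) pre → All (_< x) ys →
                           map (recordFlags pre) (insertions x ys) ≡ insertMax (recordFlags pre ys)
  recordFlags-insertions x pre []       pre<x []          rewrite allᵇ-<ᵇ-true pre pre<x = refl
  recordFlags-insertions x pre (y ∷ ys) pre<x (y<x ∷ ys<x) rewrite allᵇ-<ᵇ-true pre pre<x =
    cong₂ _∷_
      (cong (true ∷_) (recordFlags-belowRevealed (x ∷ pre) pre (y ∷ ys) (here refl) (y<x ∷ ys<x)))
      (begin
        map (recordFlags pre) (map (y ∷_) (insertions x ys))  ≡⟨ map-∘ (insertions x ys) ⟨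
        map ((b ∷_) ∘ recordFlags (y ∷ pre)) (insertions x ys) ≡⟨ map-∘ (insertions x ys) ⟩
        map (b ∷_) (map (recordFlags (y ∷ pre)) (insertions x ys))
          ≡⟨ cong (map (b ∷_)) (recordFlags-insertions x (y ∷ pre) ys (y<x ∷ pre<x) ys<x) ⟩
        map (b ∷_) (insertMax (recordFlags (y ∷ pre) ys)) ∎)
    where
    open ≡-Reasoning
    b = allᵇ (_<ᵇ y) pre

  insertions-bounded : ∀ {b} x ys → x < b → All (_< b) ys → All (All (_< b)) (insertions x ys)
  insertions-bounded x []       x<b []         = (x<b ∷ []) ∷ []
  insertions-bounded x (y ∷ ys) x<b (y<b ∷ ys<b) =
    (x<b ∷ y<b ∷ ys<b) ∷ map⁺ (All.map (y<b ∷_) (insertions-bounded x ys x<b ys<b))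

  perms-bounded : ∀ n → All (All (_< n)) (perms n)
  perms-bounded zero    = [] ∷ []
  perms-bounded (suc n) =
    All-concatMap (insertions n) (λ π<n → insertions-bounded n _ ≤-refl (All.map m≤n⇒m≤1+n π<n)) (perms-bounded n)

  recordFlags-perms : ∀ n → map (recordFlags []) (perms n) ≡ recordWords n
  recordFlags-perms zero    = refl
  recordFlags-perms (suc n) =
    trans (map-concatMap-insertions (perms n) (perms-bounded n)) (cong (concatMap insertMax) (recordFlags-perms n))
    where
    map-concatMap-insertions : ∀ πs → All (All (_< n)) πs →
      map (recordFlags []) (concatMap (insertions n) πs) ≡ concatMap insertMax (map (recordFlags []) πs)
    map-concatMap-insertions []       []           = refl
    map-concatMap-insertions (π ∷ πs) (π<n ∷ πs<n) =
      trans (map-++ (recordFlags []) (insertions n π) _)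
            (cong₂ _++_ (recordFlags-insertions n [] π [] π<n) (map-concatMap-insertions πs πs<n))

  length-insertMax : ∀ bs → All (λ cs → length cs ≡ suc (length bs)) (insertMax bs)
  length-insertMax []       = refl ∷ []
  length-insertMax (b ∷ bs) =
    cong suc (length-map (const false) (b ∷ bs)) ∷ map⁺ (All.map (cong suc) (length-insertMax bs))

  length-recordWords : ∀ n → All (λ bs → length bs ≡ n) (recordWords n)
  length-recordWords zero    = refl ∷ []
  length-recordWords (suc n) =
    All-concatMap insertMax (λ {bs} len≡n → All.map (λ e → trans e (cong suc len≡n)) (length-insertMax bs))
                  (length-recordWords n)

  insertMax-∷ʳ : ∀ bs c → insertMax (bs ∷ʳ c) ≡ map (_∷ʳ false) (insertMax bs) ∷ʳ (bs ∷ʳ c ∷ʳ true)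
  insertMax-∷ʳ []       c = refl
  insertMax-∷ʳ (b ∷ bs) c = cong₂ _∷_
    (cong (λ fs → true ∷ false ∷ fs) (map-++ (const false) bs (c ∷ [])))
    (begin
      map (b ∷_) (insertMax (bs ∷ʳ c))                         ≡⟨ cong (map (b ∷_)) (insertMax-∷ʳ bs c) ⟩
      map (b ∷_) (map (_∷ʳ false) (insertMax bs) ∷ʳ (bs ∷ʳ c ∷ʳ true))
                                                               ≡⟨ map-++ (b ∷_) (map (_∷ʳ false) (insertMax bs)) _ ⟩
      map (b ∷_) (map (_∷ʳ false) (insertMax bs)) ∷ʳ whole      ≡⟨ cong (_∷ʳ whole) (map-∘ (insertMax bs)) ⟨
      map ((b ∷_) ∘ (_∷ʳ false)) (insertMax bs) ∷ʳ whole        ≡⟨ cong (_∷ʳ whole) (map-∘ (insertMax bs)) ⟩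
      map (_∷ʳ false) (map (b ∷_) (insertMax bs)) ∷ʳ whole      ∎)
    where
    open ≡-Reasoning
    whole = b ∷ bs ∷ʳ c ∷ʳ true

  sumOver-insertMax-∷ʳ : ∀ bs c (h : List Bool → ℕ) →
    sumOver (insertMax (bs ∷ʳ c)) h ≡ sumOver (insertMax bs) (h ∘ (_∷ʳ false)) + h (bs ∷ʳ c ∷ʳ true)
  sumOver-insertMax-∷ʳ bs c h = begin
    sumOver (insertMax (bs ∷ʳ c)) h
      ≡⟨ cong (λ ws → sumOver ws h) (insertMax-∷ʳ bs c) ⟩
    sumOver (map (_∷ʳ false) (insertMax bs) ∷ʳ (bs ∷ʳ c ∷ʳ true)) h
      ≡⟨ sumOver-++ (map (_∷ʳ false) (insertMax bs)) _ h ⟩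
    sumOver (map (_∷ʳ false) (insertMax bs)) h + (h (bs ∷ʳ c ∷ʳ true) + 0)
      ≡⟨ cong₂ _+_ (sumOver-map (_∷ʳ false) (insertMax bs) h) (+-identityʳ _) ⟩
    sumOver (insertMax bs) (h ∘ (_∷ʳ false)) + h (bs ∷ʳ c ∷ʳ true) ∎
    where open ≡-Reasoning

  sumOver-recordWords-suc : ∀ m (h : List Bool → ℕ) →
    sumOver (recordWords (suc m)) h
      ≡ sumOver (recordWords m) (h ∘ (_∷ʳ true)) + m * sumOver (recordWords m) (h ∘ (_∷ʳ false))
  sumOver-recordWords-suc zero    h = sym (+-identityʳ _)
  sumOver-recordWords-suc (suc m) h = begin
    sumOver (recordWords (suc (suc m))) h
      ≡⟨ sumOver-concatMap insertMax (recordWords (suc m)) h ⟩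
    sumOver (recordWords (suc m)) (λ bs → sumOver (insertMax bs) h)
      ≡⟨ sumOver-recordWords-suc m _ ⟩
    sumOver W (h′ true) + m * sumOver W (h′ false)
      ≡⟨ cong₂ (λ u v → u + m * v) (split true) (split false) ⟩
    (X + Y true) + m * (X + Y false)
      ≡⟨ solve 4 (λ x y₁ y₀ m → (x :+ y₁) :+ m :* (x :+ y₀) := (y₁ :+ m :* y₀) :+ (x :+ m :* x))
                 refl X (Y true) (Y false) m ⟩
    (Y true + m * Y false) + suc m * X
      ≡⟨ cong (_+ suc m * X) (sumOver-recordWords-suc m (h ∘ (_∷ʳ true))) ⟨
    sumOver (recordWords (suc m)) (h ∘ (_∷ʳ true)) + suc m * X ∎
    where
    open ≡-Reasoning
    W = recordWords m
    X = sumOver (recordWords (suc m)) (h ∘ (_∷ʳ false))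
    Y : Bool → ℕ
    Y c = sumOver W (λ bs → h (bs ∷ʳ c ∷ʳ true))
    h′ : Bool → List Bool → ℕ
    h′ c bs = sumOver (insertMax (bs ∷ʳ c)) h
    split : ∀ c → sumOver W (h′ c) ≡ X + Y c
    split c = begin
      sumOver W (h′ c)
        ≡⟨ sumOver-cong (All.universal (λ bs → sumOver-insertMax-∷ʳ bs c h) W) ⟩
      sumOver W (λ bs → sumOver (insertMax bs) (h ∘ (_∷ʳ false)) + h (bs ∷ʳ c ∷ʳ true))
        ≡⟨ sumOver-+ W _ _ ⟩
      sumOver W (λ bs → sumOver (insertMax bs) (h ∘ (_∷ʳ false))) + Y c
        ≡⟨ cong (_+ Y c) (sumOver-concatMap insertMax W (h ∘ (_∷ʳ false))) ⟨
      X + Y c ∎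

  selectionsᴿ-∷ʳ-false : ∀ n ks bs → selectionsᴿ n ks (bs ∷ʳ false) ≡ selectionsᴿ n ks bs
  selectionsᴿ-∷ʳ-false n []       []       = refl
  selectionsᴿ-∷ʳ-false n (k ∷ ks) []       rewrite ∧-zeroʳ (k <ᵇ suc n) = refl
  selectionsᴿ-∷ʳ-false n []       (b ∷ bs) = refl
  selectionsᴿ-∷ʳ-false n (k ∷ ks) (b ∷ bs) with (k <ᵇ suc n) ∧ b
  ... | true  = cong suc (selectionsᴿ-∷ʳ-false (suc n) ks bs)
  ... | false = selectionsᴿ-∷ʳ-false (suc n) (k ∷ ks) bs

  selectionsᴿ-∷ʳ-true : ∀ n ks bs → All (_≤ n + length bs) ks →
                        selectionsᴿ n ks (bs ∷ʳ true) ≡ length ks ⊓ suc (selectionsᴿ n ks bs)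
  selectionsᴿ-∷ʳ-true n []       []       _       = refl
  selectionsᴿ-∷ʳ-true n (k ∷ ks) []       (k≤n ∷ _)
    rewrite Equivalence.to T-≡ (<⇒<ᵇ (s≤s (≤-trans k≤n (≤-reflexive (+-identityʳ n))))) =
    cong suc (sym (⊓-zeroʳ (length ks)))
  selectionsᴿ-∷ʳ-true n []       (b ∷ bs) _       = refl
  selectionsᴿ-∷ʳ-true n (k ∷ ks) (b ∷ bs) ks≤ with (k <ᵇ suc n) ∧ b
  ... | true  = cong suc (selectionsᴿ-∷ʳ-true (suc n) ks bs (All.tail (All.map (≤-+-suc n (length bs)) ks≤)))
  ... | false = selectionsᴿ-∷ʳ-true (suc n) (k ∷ ks) bs (All.map (≤-+-suc n (length bs)) ks≤)

  selectionsᴿ-dropLastThreshold : ∀ n ks t bs → selectionsᴿ n ks bs ≡ length ks ⊓ selectionsᴿ n (ks ∷ʳ t) bs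
  selectionsᴿ-dropLastThreshold n ks       t []       = sym (⊓-zeroʳ (length ks))
  selectionsᴿ-dropLastThreshold n []       t (b ∷ bs) = refl
  selectionsᴿ-dropLastThreshold n (k ∷ ks) t (b ∷ bs) with (k <ᵇ suc n) ∧ b
  ... | true  = cong suc (selectionsᴿ-dropLastThreshold (suc n) ks t bs)
  ... | false = selectionsᴿ-dropLastThreshold (suc n) (k ∷ ks) t bs

  selectionsᴿ-lastThresholdUnreached : ∀ n ks t bs → n + length bs ≤ t → selectionsᴿ n (ks ∷ʳ t) bs ≤ length ks
  selectionsᴿ-lastThresholdUnreached n ks       t []       _ = z≤n
  selectionsᴿ-lastThresholdUnreached n []       t (b ∷ bs) n+bs≤t
    rewrite ≥⇒<ᵇ≡false {t} {suc n} (≤-trans (s≤s (m≤m+n n (length bs))) (+-suc-≤ n (length bs) n+bs≤t)) =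
    selectionsᴿ-lastThresholdUnreached (suc n) [] t bs (+-suc-≤ n (length bs) n+bs≤t)
  selectionsᴿ-lastThresholdUnreached n (k ∷ ks) t (b ∷ bs) n+bs≤t with (k <ᵇ suc n) ∧ b
  ... | true  = s≤s (selectionsᴿ-lastThresholdUnreached (suc n) ks t bs (+-suc-≤ n (length bs) n+bs≤t))
  ... | false = selectionsᴿ-lastThresholdUnreached (suc n) (k ∷ ks) t bs (+-suc-≤ n (length bs) n+bs≤t)

  selectionsᴿ-lastRecord : ∀ n ks t bs → All (_≤ n + length bs) (ks ∷ʳ t) →
                           selectionsᴿ n (ks ∷ʳ t) (bs ∷ʳ true) ≡ suc (selectionsᴿ n ks bs)
  selectionsᴿ-lastRecord n ks t bs ks≤ = begin
    selectionsᴿ n ks⁺ (bs ∷ʳ true)               ≡⟨ selectionsᴿ-∷ʳ-true n ks⁺ bs ks≤ ⟩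
    length ks⁺ ⊓ suc (selectionsᴿ n ks⁺ bs)       ≡⟨ cong (_⊓ suc (selectionsᴿ n ks⁺ bs)) (length-∷ʳ ks t) ⟩
    suc (length ks ⊓ selectionsᴿ n ks⁺ bs)        ≡⟨ cong suc (selectionsᴿ-dropLastThreshold n ks t bs) ⟨
    suc (selectionsᴿ n ks bs)                     ∎
    where
    open ≡-Reasoning
    ks⁺ = ks ∷ʳ t

  atMost : ℕ → List ℕ → List Bool → ℕ
  atMost q ks bs = indicator (selectionsᴿ 0 ks bs ≤ᵇ q)

  Tcount≡sumOver-recordWords : ∀ q m ks → Tcount q m ks ≡ sumOver (recordWords m) (atMost q ks)
  Tcount≡sumOver-recordWords q m ks = begin
    Tcount q m ks
      ≡⟨ length-filter≡sumOver (λ π → selections ks π ≤? q) (perms m) ⟩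
    sumOver (perms m) (λ π → indicator (selections ks π ≤ᵇ q))
      ≡⟨ sumOver-cong (All.universal (λ π → cong (λ s → indicator (s ≤ᵇ q)) (selectionsFrom-recordFlags [] ks π))
                                     (perms m)) ⟩
    sumOver (perms m) (atMost q ks ∘ recordFlags [])
      ≡⟨ sumOver-map (recordFlags []) (perms m) (atMost q ks) ⟨
    sumOver (map (recordFlags []) (perms m)) (atMost q ks)
      ≡⟨ cong (λ ws → sumOver ws (atMost q ks)) (recordFlags-perms m) ⟩
    sumOver (recordWords m) (atMost q ks) ∎
    where open ≡-Reasoning

  sumOver-recordWords-one : ∀ m → sumOver (recordWords m) (const 1) ≡ m !
  sumOver-recordWords-one zero    = refl
  sumOver-recordWords-one (suc m) =
    trans (sumOver-recordWords-suc m (const 1)) (cong (λ s → s + m * s) (sumOver-recordWords-one m))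

  Tcount-lastThreshold : ∀ r ks t → length ks ≡ r → Tcount r t (ks ∷ʳ t) ≡ t !
  Tcount-lastThreshold r ks t refl = begin
    Tcount r t (ks ∷ʳ t)                         ≡⟨ Tcount≡sumOver-recordWords r t (ks ∷ʳ t) ⟩
    sumOver (recordWords t) (atMost r (ks ∷ʳ t))  ≡⟨ sumOver-cong (All.map (λ {bs} → lastUnselected bs) (length-recordWords t)) ⟩
    sumOver (recordWords t) (const 1)            ≡⟨ sumOver-recordWords-one t ⟩
    t !                                          ∎
    where
    open ≡-Reasoning
    lastUnselected : ∀ bs → length bs ≡ t → atMost r (ks ∷ʳ t) bs ≡ 1
    lastUnselected bs len≡t =
      indicator-≤ᵇ (selectionsᴿ-lastThresholdUnreached 0 ks t bs (≤-reflexive len≡t))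

  Tcount-suc : ∀ r ks t n → All (_≤ t) ks → t ≤ n →
               Tcount r (suc n) (ks ∷ʳ t) ≡ n * Tcount r n (ks ∷ʳ t) + Tshift r n ks
  Tcount-suc r ks t n ks≤t t≤n = begin
    Tcount r (suc n) ks⁺
      ≡⟨ Tcount≡sumOver-recordWords r (suc n) ks⁺ ⟩
    sumOver (recordWords (suc n)) (atMost r ks⁺)
      ≡⟨ sumOver-recordWords-suc n (atMost r ks⁺) ⟩
    sumOver (recordWords n) (atMost r ks⁺ ∘ (_∷ʳ true)) + n * sumOver (recordWords n) (atMost r ks⁺ ∘ (_∷ʳ false))
      ≡⟨ cong₂ (λ u v → u + n * v) (lastIsRecord r) (sumOver-cong (All.universal lastIsNotRecord (recordWords n))) ⟩
    Tshift r n ks + n * sumOver (recordWords n) (atMost r ks⁺)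
      ≡⟨ cong (λ c → Tshift r n ks + n * c) (Tcount≡sumOver-recordWords r n ks⁺) ⟨
    Tshift r n ks + n * Tcount r n ks⁺
      ≡⟨ +-comm (Tshift r n ks) _ ⟩
    n * Tcount r n ks⁺ + Tshift r n ks ∎
    where
    open ≡-Reasoning
    ks⁺ = ks ∷ʳ t
    lastIsNotRecord : ∀ bs → atMost r ks⁺ (bs ∷ʳ false) ≡ atMost r ks⁺ bs
    lastIsNotRecord bs = cong (λ s → indicator (s ≤ᵇ r)) (selectionsᴿ-∷ʳ-false 0 ks⁺ bs)
    lastSelected : ∀ q bs → length bs ≡ n → atMost q ks⁺ (bs ∷ʳ true) ≡ indicator (suc (selectionsᴿ 0 ks bs) ≤ᵇ q)
    lastSelected q bs len≡n = cong (λ s → indicator (s ≤ᵇ q)) (selectionsᴿ-lastRecord 0 ks t bs ks⁺≤len)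
      where
      ks⁺≤len = All.map (λ k≤t → ≤-trans k≤t (≤-trans t≤n (≤-reflexive (sym len≡n)))) (++⁺ ks≤t (≤-refl ∷ []))
    lastIsRecord : ∀ q → sumOver (recordWords n) (atMost q ks⁺ ∘ (_∷ʳ true)) ≡ Tshift q n ks
    lastIsRecord zero    =
      trans (sumOver-cong (All.map (λ {bs} → lastSelected 0 bs) (length-recordWords n))) (sumOver-zero (recordWords n))
    lastIsRecord (suc q) =
      trans (sumOver-cong (All.map (λ {bs} len≡n → trans (lastSelected (suc q) bs len≡n)
                                                         (cong indicator (≤ᵇ-suc (selectionsᴿ 0 ks bs) q)))
                                   (length-recordWords n)))
            (sym (Tcount≡sumOver-recordWords q n ks))

open RecordCounting using (Tcount-lastThreshold; Tcount-suc)

open import Data.Integer as ℤ using (+_)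
open import Data.Integer.Properties using (pos-+; pos-*)
open import Data.Integer.Solver as ℤ-Solver using ()
open import Data.Rational using (ℚ; 0ℚ; _/_; _+_; _*_; fromℚᵘ)
open import Data.Rational.Properties
  using (toℚᵘ-injective; toℚᵘ-fromℚᵘ; fromℚᵘ-cong; toℚᵘ-homo-+; toℚᵘ-homo-*)
  renaming (+-identityˡ to +ℚ-identityˡ; +-identityʳ to +ℚ-identityʳ; +-assoc to +ℚ-assoc)
open import Data.Rational.Solver as ℚ-Solver using ()
open import Data.Rational.Unnormalised as ℚᵘ using (mkℚᵘ; *≡*)
open import Data.Rational.Unnormalised.Properties using (≃-trans; ≃-sym) renaming (+-cong to +ᵘ-cong; *-cong to *ᵘ-cong)

fromℚᵘ-homo-+ : ∀ p q → fromℚᵘ (p ℚᵘ.+ q) ≡ fromℚᵘ p + fromℚᵘ q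
fromℚᵘ-homo-+ p q = toℚᵘ-injective (≃-trans (toℚᵘ-fromℚᵘ (p ℚᵘ.+ q)) (≃-sym (≃-trans
  (toℚᵘ-homo-+ (fromℚᵘ p) (fromℚᵘ q)) (+ᵘ-cong (toℚᵘ-fromℚᵘ p) (toℚᵘ-fromℚᵘ q)))))

fromℚᵘ-homo-* : ∀ p q → fromℚᵘ (p ℚᵘ.* q) ≡ fromℚᵘ p * fromℚᵘ q
fromℚᵘ-homo-* p q = toℚᵘ-injective (≃-trans (toℚᵘ-fromℚᵘ (p ℚᵘ.* q)) (≃-sym (≃-trans
  (toℚᵘ-homo-* (fromℚᵘ p) (fromℚᵘ q)) (*ᵘ-cong (toℚᵘ-fromℚᵘ p) (toℚᵘ-fromℚᵘ q)))))

fromℕ : ℕ → ℚ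
fromℕ a = + a / 1

fromℕ-+ : ∀ a b → fromℕ (a ℕ.+ b) ≡ fromℕ a + fromℕ b
fromℕ-+ a b =
  trans (fromℚᵘ-cong {mkℚᵘ (+ (a ℕ.+ b)) 0} {mkℚᵘ (+ a) 0 ℚᵘ.+ mkℚᵘ (+ b) 0} (*≡* eq))
        (fromℚᵘ-homo-+ (mkℚᵘ (+ a) 0) (mkℚᵘ (+ b) 0))
  where
  open ℤ-Solver.+-*-Solver
  eq : + (a ℕ.+ b) ℤ.* + 1 ≡ (+ a ℤ.* + 1 ℤ.+ + b ℤ.* + 1) ℤ.* + 1
  eq rewrite pos-+ a b =
    solve 2 (λ x y → (x :+ y) :* con (+ 1) := (x :* con (+ 1) :+ y :* con (+ 1)) :* con (+ 1)) refl (+ a) (+ b)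

fromℕ-* : ∀ a b → fromℕ (a ℕ.* b) ≡ fromℕ a * fromℕ b
fromℕ-* a b =
  trans (fromℚᵘ-cong {mkℚᵘ (+ (a ℕ.* b)) 0} {mkℚᵘ (+ a) 0 ℚᵘ.* mkℚᵘ (+ b) 0} (*≡* (cong (ℤ._* + 1) (pos-* a b))))
        (fromℚᵘ-homo-* (mkℚᵘ (+ a) 0) (mkℚᵘ (+ b) 0))

fromℕ-*-/ : ∀ b c .{{_ : NonZero c}} → fromℕ c * (+ b / c) ≡ fromℕ b
fromℕ-*-/ b (suc c) =
  trans (sym (fromℚᵘ-homo-* (mkℚᵘ (+ suc c) 0) (mkℚᵘ (+ b) c)))
        (fromℚᵘ-cong {mkℚᵘ (+ suc c) 0 ℚᵘ.* mkℚᵘ (+ b) c} {mkℚᵘ (+ b) 0} (*≡* eq))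
  where
  open ℤ-Solver.+-*-Solver
  eq : (+ suc c ℤ.* + b) ℤ.* + 1 ≡ + b ℤ.* (+ 1 ℤ.* + suc c)
  eq = solve 2 (λ x y → (x :* y) :* con (+ 1) := y :* (con (+ 1) :* x)) refl (+ suc c) (+ b)

foldr-+-init : ∀ (c : ℚ) xs → foldr _+_ c xs ≡ foldr _+_ 0ℚ xs + c
foldr-+-init c []       = sym (+ℚ-identityˡ c)
foldr-+-init c (x ∷ xs) = trans (cong (_+_ x) (foldr-+-init c xs)) (sym (+ℚ-assoc x _ c))

sumFromTo-empty : ∀ b (g : ℕ → ℚ) → sumFromTo (suc b) b g ≡ 0ℚ
sumFromTo-empty b g rewrite n∸n≡0 b = refl

sumFromTo-extendʳ : ∀ a b (g : ℕ → ℚ) → a ≤ suc b → sumFromTo a (suc b) g ≡ sumFromTo a b g + g (suc b)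
sumFromTo-extendʳ a b g a≤1+b = begin
  Σ (applyUpTo (a ℕ.+_) (suc (suc b) ∸ a))  ≡⟨ cong (Σ ∘ applyUpTo (a ℕ.+_)) (+-∸-assoc 1 a≤1+b) ⟩
  Σ (applyUpTo (a ℕ.+_) (suc d))            ≡⟨ cong Σ (applyUpTo-∷ʳ (a ℕ.+_) d) ⟨
  Σ (is ++ a ℕ.+ d ∷ [])                    ≡⟨ cong (foldr _+_ 0ℚ) (map-++ g is _) ⟩
  foldr _+_ 0ℚ (map g is ++ g (a ℕ.+ d) ∷ []) ≡⟨ foldr-++ _+_ 0ℚ (map g is) _ ⟩
  foldr _+_ (g (a ℕ.+ d) + 0ℚ) (map g is)   ≡⟨ foldr-+-init _ (map g is) ⟩
  Σ is + (g (a ℕ.+ d) + 0ℚ)                 ≡⟨ cong (_+_ (Σ is)) (trans (+ℚ-identityʳ _) (cong g (m+[n∸m]≡n a≤1+b))) ⟩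
  Σ is + g (suc b)                          ∎
  where
  open ≡-Reasoning
  Σ : List ℕ → ℚ
  Σ = foldr _+_ 0ℚ ∘ map g
  d  = suc b ∸ a
  is = applyUpTo (a ℕ.+_) d

ratioToFactorial : (ℕ → ℕ) → ℕ → ℚ
ratioToFactorial B i = ((+ B (i ∸ 1)) / ((i ∸ 1) !)) {{(i ∸ 1) !≢0}}

module _ (t : ℕ) (A B : ℕ → ℕ) (A-init : A t ≡ t !)
         (A-step : ∀ n → t ≤ n → A (suc n) ≡ n ℕ.* A n ℕ.+ B n) where

  private
    open ℚ-Solver.+-*-Solver

    g = ratioToFactorial B

    closedForm : ℕ → ℚ
    closedForm n = fromℕ t * fromℕ ((n ∸ 1) !) + fromℕ ((n ∸ 1) !) * sumFromTo (suc t) n g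

    A-step-ℚ : ∀ n → t ≤ n → fromℕ (A (suc n)) ≡ fromℕ n * fromℕ (A n) + fromℕ (n !) * g (suc n)
    A-step-ℚ n t≤n = begin
      fromℕ (A (suc n))                            ≡⟨ cong fromℕ (A-step n t≤n) ⟩
      fromℕ (n ℕ.* A n ℕ.+ B n)                   ≡⟨ fromℕ-+ (n ℕ.* A n) (B n) ⟩
      fromℕ (n ℕ.* A n) + fromℕ (B n)             ≡⟨ cong₂ _+_ (fromℕ-* n (A n)) (sym (fromℕ-*-/ (B n) (n !) {{n !≢0}})) ⟩
      fromℕ n * fromℕ (A n) + fromℕ (n !) * g (suc n) ∎
      where open ≡-Reasoning

    closedForm-suc : ∀ n → t ≤′ n → fromℕ (A (suc n)) ≡ closedForm (suc n)
    closedForm-suc .t ≤′-refl = begin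
      fromℕ (A (suc t))                                ≡⟨ A-step-ℚ t ≤-refl ⟩
      fromℕ t * fromℕ (A t) + fromℕ (t !) * g (suc t)  ≡⟨ cong (λ a → fromℕ t * fromℕ a + fromℕ (t !) * g (suc t)) A-init ⟩
      fromℕ t * fromℕ (t !) + fromℕ (t !) * g (suc t)  ≡⟨ cong (λ s → fromℕ t * fromℕ (t !) + fromℕ (t !) * s) singleTerm ⟨
      closedForm (suc t)                               ∎
      where
      open ≡-Reasoning
      singleTerm : sumFromTo (suc t) (suc t) g ≡ g (suc t)
      singleTerm = begin
        sumFromTo (suc t) (suc t) g      ≡⟨ sumFromTo-extendʳ (suc t) t g ≤-refl ⟩
        sumFromTo (suc t) t g + g (suc t) ≡⟨ cong (_+ g (suc t)) (sumFromTo-empty t g) ⟩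
        0ℚ + g (suc t)                   ≡⟨ +ℚ-identityˡ _ ⟩
        g (suc t)                        ∎
    closedForm-suc (suc n) (≤′-step t≤′n) = begin
      fromℕ (A (suc (suc n)))
        ≡⟨ A-step-ℚ (suc n) t≤1+n ⟩
      fromℕ (suc n) * fromℕ (A (suc n)) + fromℕ (suc n !) * q
        ≡⟨ cong₂ (λ a f → fromℕ (suc n) * a + f * q) (closedForm-suc n t≤′n) (fromℕ-* (suc n) (n !)) ⟩
      fromℕ (suc n) * (fromℕ t * F + F * S) + (fromℕ (suc n) * F) * q
        ≡⟨ solve 5 (λ m t f s q → m :* (t :* f :+ f :* s) :+ (m :* f) :* q := t :* (m :* f) :+ (m :* f) :* (s :+ q))
                   refl (fromℕ (suc n)) (fromℕ t) F S q ⟩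
      fromℕ t * (fromℕ (suc n) * F) + (fromℕ (suc n) * F) * (S + q)
        ≡⟨ cong₂ (λ f s → fromℕ t * f + f * s) (fromℕ-* (suc n) (n !)) (sumFromTo-extendʳ (suc t) (suc n) g (s≤s t≤1+n)) ⟨
      closedForm (suc (suc n)) ∎
      where
      open ≡-Reasoning
      t≤1+n = m≤n⇒m≤1+n (≤′⇒≤ t≤′n)
      F = fromℕ (n !)
      S = sumFromTo (suc t) (suc n) g
      q = g (suc (suc n))

  firstOrderRecurrence-closedForm : ∀ n → 1 ≤ n → t ≤ n →
    fromℕ (A n) ≡ fromℕ t * fromℕ ((n ∸ 1) !) + fromℕ ((n ∸ 1) !) * sumFromTo (suc t) n (ratioToFactorial B)
  firstOrderRecurrence-closedForm (suc n) _ t≤1+n with m≤n⇒m<n∨m≡n t≤1+n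
  ... | inj₁ (s≤s t≤n) = closedForm-suc n (≤⇒≤′ t≤n)
  ... | inj₂ refl      = begin
    fromℕ (A t)                               ≡⟨ trans (cong fromℕ A-init) (fromℕ-* t (n !)) ⟩
    fromℕ t * F                               ≡⟨ solve 2 (λ x y → x := x :+ y :* con 0ℚ) refl (fromℕ t * F) F ⟩
    fromℕ t * F + F * 0ℚ                      ≡⟨ cong (λ s → fromℕ t * F + F * s) (sumFromTo-empty t g) ⟨
    closedForm t                              ∎
    where
    open ≡-Reasoning
    F = fromℕ (n !)

firstK-suc : ∀ k r → firstK k (suc r) ≡ firstK k r ∷ʳ k (suc r)
firstK-suc k r = sym (applyUpTo-∷ʳ (k ∘ suc) r)

mainTheorem10 : (N s : ℕ) (k : ℕ → ℕ)
    → (∀ i j → 1 ≤ i → i ≤ j → j ≤ s → k i ≤ k j)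
    → (∀ i → 1 ≤ i → i ≤ s → k i ≤ N)
    → (r : ℕ) → 1 ≤ r → r ≤ s
    → (m : ℕ) → 1 ≤ m → k r ≤ m
    → ((+ Tcount (r ∸ 1) m (firstK k r)) / 1)
      ≡ ((+ (k r)) / 1) * ((+ ((m ∸ 1) !)) / 1)
        + ((+ ((m ∸ 1) !)) / 1)
          * sumFromTo (suc (k r)) m
              (λ i → ((+ Tshift (r ∸ 1) (i ∸ 1) (firstK k (r ∸ 1))) / ((i ∸ 1) !)) {{(i ∸ 1) !≢0}})
mainTheorem10 _ s k monotone _ (suc r-1) _ r≤s m 1≤m kᵣ≤m =
  firstOrderRecurrence-closedForm kᵣ A (λ n → Tshift r-1 n ks) A-init A-step m 1≤m kᵣ≤m
  where
  kᵣ = k (suc r-1)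
  ks = firstK k r-1
  A : ℕ → ℕ
  A n = Tcount r-1 n (firstK k (suc r-1))
  ks≤kᵣ : All (_≤ kᵣ) ks
  ks≤kᵣ = applyUpTo⁺₁ (k ∘ suc) r-1 (λ j<r-1 → monotone _ (suc r-1) (s≤s z≤n) (m≤n⇒m≤1+n j<r-1) r≤s)
  A-init : A kᵣ ≡ kᵣ !
  A-init = subst (λ ks⁺ → Tcount r-1 kᵣ ks⁺ ≡ kᵣ !) (sym (firstK-suc k r-1))
                 (Tcount-lastThreshold r-1 ks kᵣ (length-applyUpTo (k ∘ suc) r-1))
  A-step : ∀ n → kᵣ ≤ n → A (suc n) ≡ n ℕ.* A n ℕ.+ Tshift r-1 n ks
  A-step n kᵣ≤n = subst (λ ks⁺ → Tcount r-1 (suc n) ks⁺ ≡ n ℕ.* Tcount r-1 n ks⁺ ℕ.+ Tshift r-1 n ks)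
                        (sym (firstK-suc k r-1)) (Tcount-suc r-1 ks kᵣ n ks≤kᵣ kᵣ≤n)
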